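{- Let $W$ be the graph defined below, and let $W_1$ be the graph obtained from a copy $W_0$ of $W$ by replacing each of the three edges $uz$, $ux_1$, $ut$ of $W_0$ with a distinct copy of $W$, where the vertices $u$ and $v$ of that copy are identified with the two endpoints of the edge. Then the fractional arboricity of $W_1$ is $a_f(W_1)=2+\frac{2}{25}$.
   Context: $W$ is the graph on the ten vertices $u,v,w,z,t,x_1,x_2,x_3,x_4,x_5$ with the $24$ edges $wx_1,wx_2,wx_3,wx_4,wx_5$; $x_1x_2,x_2x_3,x_3x_4,x_4x_5,x_5x_1$; $zx_2,zx_3,zu,zv$; $tx_4,tx_5,tu,tv$; $ux_1,ux_2,ux_5,uv$; $vx_3,vx_4$ (it is a planar triangulation). The fractional arboricity $a_f(G)$ of a graph $G$ is the minimum of $p/q$ over positive integers $p,q$ such that one can assign to each vertex a set of $q$ colors from $\{1,\dots,p\}$ so that for each color the set of vertices receiving it induces a forest (acyclic subgraph). -}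

module Defs where

open import Data.Nat using (ℕ; _*_; _≤_; _<_)
open import Data.Fin using (Fin; #_; _↑ˡ_; _↑ʳ_; combine; zero; suc)
open import Data.Fin.Subset using (Subset; _∈_; ∣_∣)
open import Data.Product using (Σ; ∃; _×_; _,_)
open import Data.Sum using (_⊎_)
open import Data.List using (List; []; _∷_; _++_; [_]; length; map; concatMap)
open import Data.List.Relation.Unary.All using (All)
open import Data.List.Relation.Unary.Linked using (Linked)
open import Data.List.Relation.Unary.Unique.Propositional using (Unique)
import Data.List.Membership.Propositional as LM
open import Relation.Binary.PropositionalEquality using (_≡_)
open import Relation.Nullary using (¬_)
open import Data.Empty using (⊥)

EdgeList : ℕ → Set
EdgeList n = List (Fin n × Fin n)

Adj : ∀ {n} → EdgeList n → Fin n → Fin n → Set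
Adj E a b = (a , b) LM.∈ E ⊎ (b , a) LM.∈ E

IsCycle : ∀ {n} → EdgeList n → List (Fin n) → Set
IsCycle E []       = ⊥
IsCycle E (x ∷ xs) =
  (3 ≤ length (x ∷ xs)) × Unique (x ∷ xs) × Linked (Adj E) ((x ∷ xs) ++ [ x ])

InducesForest : ∀ {n} → EdgeList n → (Fin n → Set) → Set
InducesForest E S = ∀ (c : List _) → IsCycle E c → ¬ All S c

FracArbColouring : ∀ {n} → EdgeList n → ℕ → ℕ → Set
FracArbColouring {n} E p q =
  Σ (Fin n → Subset p) λ f →
    (∀ v → ∣ f v ∣ ≡ q) × (∀ (c : Fin p) → InducesForest E (λ v → c ∈ f v))

-- a_f(G) = a / b, i.e. a / b is the minimum of p / q over positive
-- p, q admitting such a colouring.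
FracArboricityIs : ∀ {n} → EdgeList n → ℕ → ℕ → Set
FracArboricityIs E a b =
  (∃ λ p → ∃ λ q → 0 < p × 0 < q × p * b ≡ a * q × FracArbColouring E p q)
  × (∀ p q → 0 < p → 0 < q → FracArbColouring E p q → a * q ≤ p * b)

u v w z t x₁ x₂ x₃ x₄ x₅ : Fin 10
u = # 0
v = # 1
w = # 2
z = # 3
t = # 4
x₁ = # 5
x₂ = # 6
x₃ = # 7
x₄ = # 8
x₅ = # 9

W : EdgeList 10
W = (w , x₁) ∷ (w , x₂) ∷ (w , x₃) ∷ (w , x₄) ∷ (w , x₅)
  ∷ (x₁ , x₂) ∷ (x₂ , x₃) ∷ (x₃ , x₄) ∷ (x₄ , x₅) ∷ (x₅ , x₁)
  ∷ (z , x₂) ∷ (z , x₃) ∷ (z , u) ∷ (z , v)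
  ∷ (t , x₄) ∷ (t , x₅) ∷ (t , u) ∷ (t , v)
  ∷ (u , x₁) ∷ (u , x₂) ∷ (u , x₅) ∷ (u , v)
  ∷ (v , x₃) ∷ (v , x₄)
  ∷ []

-- The graph W₁ on 10 + 3·8 = 34 vertices: a copy W₀ of W (vertices
-- 0..9) together with three copies of W, glued along the edges
-- uz, ux₁, ut of W₀ (copy j's u ↦ u of W₀, copy j's v ↦ the other
-- endpoint).  The 8 remaining vertices of copy j are fresh.

endpoint : Fin 3 → Fin 10
endpoint zero             = z
endpoint (suc zero)       = x₁
endpoint (suc (suc zero)) = t

base : Fin 10 → Fin 34
base k = k ↑ˡ 24

copyEmb : Fin 3 → Fin 10 → Fin 34
copyEmb j zero          = base u
copyEmb j (suc zero)    = base (endpoint j)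
copyEmb j (suc (suc k)) = 10 ↑ʳ combine j k

mapEdges : ∀ {m n} → (Fin m → Fin n) → EdgeList m → EdgeList n
mapEdges f = map (λ { (a , b) → (f a , f b) })

W₁ : EdgeList 34
W₁ = mapEdges base W
  ++ mapEdges (copyEmb (# 0)) W
  ++ mapEdges (copyEmb (# 1)) W
  ++ mapEdges (copyEmb (# 2)) W

-- Upper bound: 52 induced forests of W₁ (26 distinct ones, with multiplicities) cover every
-- vertex exactly 25 times.  Each forest is listed in an order in which every vertex has at most
-- one neighbour further on; this certifies acyclicity, because every vertex of a cycle has two
-- distinct neighbours on the cycle.
--
-- Lower bound (weak LP duality): weight the vertices of W₀ by u:7, v:2, w:2, z:3, t:3, x₁:3,
-- x₂…x₅:2 and the 24 vertices added with the three glued copies by 1, for a total of 52.  An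
-- induced forest contains at most 5, 4 or 2 of the eight inner vertices of a copy glued along
-- u–y, according as it contains none, one or both of u and y; together with the weights on W₀
-- this bounds the weight of every induced forest by 25 (both facts about W are checked on all
-- 2¹⁰ vertex sets of W).  Summing over the p colour classes of a (p, q)-colouring gives
-- 52 q ≤ 25 p.
module Submission where

open import Defs

open import Data.Bool using (Bool; true; false)
open import Data.Bool.Properties using (T-≡)
open import Data.Empty using (⊥-elim)
open import Data.Fin using (Fin; zero; suc; #_)
open import Data.Fin.Properties using (_≟_; all?; ↑ˡ-injective)
open import Data.Fin.Subset using (Subset; ∣_∣; inside; outside) renaming (_∈_ to _∈ₛ_)
open import Data.Fin.Subset.Properties using (anySubset?) renaming (_∈?_ to _∈ₛ?_)
open import Data.List using (List; []; _∷_; _++_; [_]; _∷ʳ_; length; filter; map; concatMap; replicate; lookup; initLast; _∷ʳ′_)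
open import Data.List.Properties using (length-++; ++-assoc; ++-identityʳ; length-map; map-++)
open import Data.List.Relation.Unary.All as All using (All; []; _∷_)
import Data.List.Relation.Unary.All.Properties as All
open import Data.List.Relation.Unary.AllPairs using (AllPairs; []; _∷_; allPairs?)
open import Data.List.Relation.Unary.Any as Any using (Any; here; there; any?)
import Data.List.Relation.Unary.Any.Properties as Any
open import Data.List.Relation.Unary.Linked as Linked using (Linked; []; [-]; _∷_; linked?)
import Data.List.Relation.Unary.Linked.Properties as Linked
import Data.List.Relation.Unary.Unique.Propositional.Properties as Unique
import Data.List.Relation.Unary.Unique.DecPropositional as UniqueDec
open import Data.List.Membership.Propositional using (_∈_)
open import Data.List.Membership.Propositional.Properties using (∈-∃++; ∈-++⁺ˡ; ∈-++⁺ʳ; ∈-filter⁺; ∈-map⁺)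
import Data.List.Membership.DecPropositional as DecMembership
open import Data.Nat using (ℕ; zero; suc; _+_; _*_; _≤_; s≤s; z≤n; _≤?_)
open import Data.Nat.Properties using (+-comm; +-assoc; +-mono-≤; +-monoʳ-≤; ≤-refl; +-0-commutativeMonoid; module ≤-Reasoning) renaming (_≟_ to _≟ℕ_)
open import Algebra.Properties.CommutativeMonoid.Sum +-0-commutativeMonoid using (sum-syntax; ∑-distrib-+; sum-cong-≗; sum-replicate-zero)
open import Data.Product using (∃₂; _×_; _,_; proj₁; proj₂; uncurry)
open import Data.Product.Properties using (≡-dec)
open import Data.Sum as Sum using (_⊎_; inj₁; inj₂; swap; [_,_]′)
open import Data.Vec using ([]; _∷_; tabulate) renaming (lookup to _!_)
open import Data.Vec.Properties using (lookup∘tabulate; []=⇒lookup; lookup⇒[]=)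
open import Function using (_∘_; id; case_of_)
open import Function.Bundles using (Equivalence)
open import Relation.Binary.PropositionalEquality using (_≡_; _≢_; refl; sym; trans; subst; cong; cong₂; ≢-sym; module ≡-Reasoning)
open import Relation.Nullary using (Dec; yes; no)
open import Relation.Nullary.Decidable using (isYes; from-yes; toWitness; map′; ¬?; decidable-stable; _×-dec_; _⊎-dec_; _→-dec_)
open import Relation.Unary using (Decidable)

module _ {A : Set} {R : A → A → Set} where

  Linked-∷ʳ⁺ : ∀ xs {y z} → Linked R (xs ∷ʳ y) → R y z → Linked R (xs ∷ʳ y ∷ʳ z)
  Linked-∷ʳ⁺ []            [-]       y~z = y~z ∷ [-]
  Linked-∷ʳ⁺ (x ∷ [])      (x~ ∷ ys) y~z = x~ ∷ Linked-∷ʳ⁺ [] ys y~z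
  Linked-∷ʳ⁺ (x ∷ x′ ∷ xs) (x~ ∷ ys) y~z = x~ ∷ Linked-∷ʳ⁺ (x′ ∷ xs) ys y~z

  Linked-∷ʳ⁻ : ∀ xs {y z} → Linked R (xs ∷ʳ y ∷ʳ z) → R y z
  Linked-∷ʳ⁻ []       (y~z ∷ _) = y~z
  Linked-∷ʳ⁻ (x ∷ xs) links     = Linked-∷ʳ⁻ xs (Linked.tail links)

AllPairs-≡⇒≡ : ∀ {A : Set} {xs : List A} {a b} →
               AllPairs _≡_ xs → a ∈ xs → b ∈ xs → a ≡ b
AllPairs-≡⇒≡ (x≡ ∷ _)  (here refl) (here refl) = refl
AllPairs-≡⇒≡ (x≡ ∷ _)  (here refl) (there b∈)  = All.lookup x≡ b∈
AllPairs-≡⇒≡ (x≡ ∷ _)  (there a∈)  (here refl) = sym (All.lookup x≡ a∈)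
AllPairs-≡⇒≡ (_ ∷ x≡s) (there a∈)  (there b∈)  = AllPairs-≡⇒≡ x≡s a∈ b∈

length-∷ʳ : ∀ {A : Set} (xs : List A) {x} → length (xs ∷ʳ x) ≡ length (x ∷ xs)
length-∷ʳ xs = trans (length-++ xs) (+-comm (length xs) 1)

module _ {n} {E : EdgeList n} where

  Adj-sym : ∀ {a b} → Adj E a b → Adj E b a
  Adj-sym = swap

  IsCycle-rotate : ∀ {x xs} → IsCycle E (x ∷ xs) → IsCycle E (xs ∷ʳ x)
  IsCycle-rotate {xs = []} (s≤s () , _)
  IsCycle-rotate {x} {a ∷ as} (3≤ , x∉ ∷ as! , x~a ∷ links) =
    subst (3 ≤_) (sym (length-∷ʳ (a ∷ as))) 3≤ ,
    Unique.++⁺ as! ([] ∷ []) (λ { (x∈ , here refl) → All.lookup x∉ x∈ refl }) ,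
    Linked-∷ʳ⁺ (a ∷ as) links x~a

  IsCycle-rotateTo : ∀ pre {y} post → IsCycle E (pre ++ y ∷ post) → IsCycle E (y ∷ post ++ pre)
  IsCycle-rotateTo []        {y} post cycle =
    subst (λ l → IsCycle E (y ∷ l)) (sym (++-identityʳ post)) cycle
  IsCycle-rotateTo (p ∷ pre) {y} post cycle =
    subst (λ l → IsCycle E (y ∷ l)) (++-assoc post [ p ] pre)
      (IsCycle-rotateTo pre (post ∷ʳ p)
        (subst (IsCycle E) (++-assoc pre (y ∷ post) [ p ]) (IsCycle-rotate cycle)))

  TwoNeighboursIn : List (Fin n) → Fin n → Set
  TwoNeighboursIn c y =
    ∃₂ λ a b → a ≢ b × (Adj E y a × a ≢ y × a ∈ c) × (Adj E y b × b ≢ y × b ∈ c)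

  IsCycle-headNeighbours : ∀ {y xs} → IsCycle E (y ∷ xs) → TwoNeighboursIn xs y
  IsCycle-headNeighbours {xs = []}    (s≤s () , _)
  IsCycle-headNeighbours {y} {a ∷ rest} cycle with initLast rest
  ... | []        = case cycle of λ { (s≤s (s≤s ()) , _) }
  ... | mid ∷ʳ′ b = ends cycle
    where
    b∈ : b ∈ mid ∷ʳ b
    b∈ = ∈-++⁺ʳ mid (here refl)
    ends : IsCycle E (y ∷ a ∷ mid ∷ʳ b) → TwoNeighboursIn (a ∷ mid ∷ʳ b) y
    ends (_ , (y≢a ∷ y∉) ∷ a∉ ∷ _ , y~a ∷ links) =
      a , b , All.lookup a∉ b∈ ,
      (y~a , ≢-sym y≢a , here refl) ,
      (Adj-sym (Linked-∷ʳ⁻ (y ∷ a ∷ mid) (y~a ∷ links)) , ≢-sym (All.lookup y∉ b∈) , there b∈)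

  -- Rotate the cycle to start at y: its neighbours are then the second and the last vertex.
  IsCycle⇒twoNeighbours : ∀ {c y} → IsCycle E c → y ∈ c → TwoNeighboursIn c y
  IsCycle⇒twoNeighbours cycle y∈c with pre , post , refl ← ∈-∃++ y∈c
    with a , b , a≢b , (y~a , a≢y , a∈) , (y~b , b≢y , b∈)
           ← IsCycle-headNeighbours (IsCycle-rotateTo pre post cycle)
    = a , b , a≢b , (y~a , a≢y , unrotate a∈) , (y~b , b≢y , unrotate b∈)
    where
    unrotate : ∀ {x} → x ∈ post ++ pre → x ∈ pre ++ _ ∷ post
    unrotate = Any.++-comm (_ ∷ post) pre ∘ there

module _ {n} (E : EdgeList n) where

  open DecMembership (_≟_ {n}) using (_∈?_)
  open DecMembership (≡-dec (_≟_ {n}) (_≟_ {n})) using () renaming (_∈?_ to _∈ᴱ?_)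
  open UniqueDec (_≟_ {n}) using (unique?)

  Adj? : ∀ a b → Dec (Adj E a b)
  Adj? a b = ((a , b) ∈ᴱ? E) ⊎-dec ((b , a) ∈ᴱ? E)

  IsCycle? : Decidable (IsCycle E)
  IsCycle? []       = no λ ()
  IsCycle? (x ∷ xs) =
    (3 ≤? length (x ∷ xs)) ×-dec (unique? (x ∷ xs) ×-dec linked? Adj? ((x ∷ xs) ++ [ x ]))

  neighbours : Fin n → List (Fin n)
  neighbours v = map proj₂ (filter ((_≟ v) ∘ proj₁) E) ++ map proj₁ (filter ((_≟ v) ∘ proj₂) E)

  Adj⇒∈neighbours : ∀ {v y} → Adj E v y → y ∈ neighbours v
  Adj⇒∈neighbours (inj₁ vy∈E) = ∈-++⁺ˡ (∈-map⁺ proj₂ (∈-filter⁺ ((_≟ _) ∘ proj₁) vy∈E refl))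
  Adj⇒∈neighbours (inj₂ yv∈E) = ∈-++⁺ʳ _ (∈-map⁺ proj₁ (∈-filter⁺ ((_≟ _) ∘ proj₂) yv∈E refl))

  AtMostOneNeighbourIn : List (Fin n) → Fin n → Set
  AtMostOneNeighbourIn S v = AllPairs _≡_ (filter (_∈? S) (neighbours v))

  data LeafOrder : List (Fin n) → Set where
    []  : LeafOrder []
    _∷_ : ∀ {v S} → AtMostOneNeighbourIn S v → LeafOrder S → LeafOrder (v ∷ S)

  leafOrder? : Decidable LeafOrder
  leafOrder? []      = yes []
  leafOrder? (v ∷ S) =
    map′ (uncurry _∷_) (λ { (v! ∷ S!) → v! , S! })
         (allPairs? _≟_ (filter (_∈? S) (neighbours v)) ×-dec leafOrder? S)

  InducesForest-mono : ∀ {S T : Fin n → Set} → (∀ {x} → S x → T x) →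
                       InducesForest E T → InducesForest E S
  InducesForest-mono S⊆T forest c cycle c⊆S = forest c cycle (All.map S⊆T c⊆S)

  LeafOrder⇒InducesForest : ∀ {S} → LeafOrder S → InducesForest E (_∈ S)
  LeafOrder⇒InducesForest []                (_ ∷ _) _     (() ∷ _)
  LeafOrder⇒InducesForest {v ∷ S} (v! ∷ S!) c       cycle c⊆ with v ∈? c
  ... | yes v∈c =
    let a , b , a≢b , (v~a , a≢v , a∈c) , (v~b , b≢v , b∈c) = IsCycle⇒twoNeighbours cycle v∈c
    in a≢b (AllPairs-≡⇒≡ v! (neighbour a∈c a≢v v~a) (neighbour b∈c b≢v v~b))
    where
    neighbour : ∀ {x} → x ∈ c → x ≢ v → Adj E v x → x ∈ filter (_∈? S) (neighbours v)
    neighbour x∈c x≢v v~x =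
      ∈-filter⁺ (_∈? S) (Adj⇒∈neighbours v~x) (Any.tail x≢v (All.lookup c⊆ x∈c))
  ... | no v∉c =
    LeafOrder⇒InducesForest S! c cycle
      (All.tabulate λ x∈c → Any.tail (λ { refl → v∉c x∈c }) (All.lookup c⊆ x∈c))

Adj-mono : ∀ {n} {E E′ : EdgeList n} → (∀ {ab} → ab ∈ E → ab ∈ E′) → ∀ {a b} → Adj E a b → Adj E′ a b
Adj-mono E⊆E′ = Sum.map E⊆E′ E⊆E′

Adj-mapEdges : ∀ {m n} {E : EdgeList m} (e : Fin m → Fin n) {a b} →
               Adj E a b → Adj (mapEdges e E) (e a) (e b)
Adj-mapEdges e = Sum.map (∈-map⁺ _) (∈-map⁺ _)

𝟙 : Bool → ℕ
𝟙 true  = 1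
𝟙 false = 0

count : ∀ {n} → Subset n → List (Fin n) → ℕ
count S []       = 0
count S (x ∷ xs) = 𝟙 (S ! x) + count S xs

count-++ : ∀ {n} S (xs ys : List (Fin n)) → count S (xs ++ ys) ≡ count S xs + count S ys
count-++ S []       ys = refl
count-++ S (x ∷ xs) ys =
  trans (cong (𝟙 (S ! x) +_) (count-++ S xs ys)) (sym (+-assoc (𝟙 (S ! x)) (count S xs) (count S ys)))

∈-tabulate⁻ : ∀ {n} {g : Fin n → Bool} {x} → x ∈ₛ tabulate g → g x ≡ true
∈-tabulate⁻ {g = g} {x} x∈ = trans (sym (lookup∘tabulate g x)) ([]=⇒lookup x∈)

∑-𝟙 : ∀ {n} (S : Subset n) → ∑[ i < n ] 𝟙 (S ! i) ≡ ∣ S ∣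
∑-𝟙 []            = refl
∑-𝟙 (inside  ∷ S) = cong suc (∑-𝟙 S)
∑-𝟙 (outside ∷ S) = ∑-𝟙 S

∑-≤ : ∀ {n} (g : Fin n → ℕ) {B} → (∀ i → g i ≤ B) → ∑[ i < n ] g i ≤ n * B
∑-≤ {zero}  g g≤B = ≤-refl
∑-≤ {suc n} g g≤B = +-mono-≤ (g≤B zero) (∑-≤ (g ∘ suc) (g≤B ∘ suc))

preimage : ∀ {m n} → (Fin m → Fin n) → Subset n → Subset m
preimage e S = tabulate (λ x → S ! e x)

count-map : ∀ {m n} (e : Fin m → Fin n) S xs → count S (map e xs) ≡ count (preimage e S) xs
count-map e S []       = refl
count-map e S (x ∷ xs) =
  cong₂ _+_ (cong 𝟙 (sym (lookup∘tabulate (λ x → S ! e x) x))) (count-map e S xs)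

colourClass : ∀ {n p} → (Fin n → Subset p) → Fin p → Subset n
colourClass f c = tabulate λ v → f v ! c

∑-count-colourClass : ∀ {n p q} (f : Fin n → Subset p) → (∀ v → ∣ f v ∣ ≡ q) →
                      ∀ xs → ∑[ c < p ] count (colourClass f c) xs ≡ length xs * q
∑-count-colourClass {p = p} f ∣f∣≡q []           = sum-replicate-zero p
∑-count-colourClass {p = p} {q} f ∣f∣≡q (x ∷ xs) = begin
  ∑[ c < p ] (𝟙 (colourClass f c ! x) + count (colourClass f c) xs)
    ≡⟨ ∑-distrib-+ (λ c → 𝟙 (colourClass f c ! x)) (λ c → count (colourClass f c) xs) ⟩
  ∑[ c < p ] 𝟙 (colourClass f c ! x) + ∑[ c < p ] count (colourClass f c) xs
    ≡⟨ cong₂ _+_ (sum-cong-≗ (λ c → cong 𝟙 (lookup∘tabulate (λ v → f v ! c) x)))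
                 (∑-count-colourClass f ∣f∣≡q xs) ⟩
  ∑[ c < p ] 𝟙 (f x ! c) + length xs * q
    ≡⟨ cong (_+ length xs * q) (trans (∑-𝟙 (f x)) (∣f∣≡q x)) ⟩
  q + length xs * q ∎
  where open ≡-Reasoning

weighting⇒lowerBound : ∀ {n} {E : EdgeList n} xs B →
                       (∀ S → InducesForest E (_∈ₛ S) → count S xs ≤ B) →
                       ∀ {p q} → FracArbColouring E p q → length xs * q ≤ p * B
weighting⇒lowerBound {E = E} xs B bound {p} {q} (f , ∣f∣≡q , classForest) = begin
  length xs * q                          ≡⟨ sym (∑-count-colourClass f ∣f∣≡q xs) ⟩
  ∑[ c < p ] count (colourClass f c) xs  ≤⟨ ∑-≤ _ (λ c → bound (colourClass f c) (classForest′ c)) ⟩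
  p * B                                  ∎
  where
  open ≤-Reasoning
  classForest′ : ∀ c → InducesForest E (_∈ₛ colourClass f c)
  classForest′ c =
    InducesForest-mono E (λ {v} v∈ → lookup⇒[]= c (f v) (∈-tabulate⁻ v∈)) (classForest c)

module _ {m n} {E : EdgeList m} {E′ : EdgeList n} {e : Fin m → Fin n}
         (e-injective : ∀ {a b} → e a ≡ e b → a ≡ b)
         (e-adj : ∀ {a b} → Adj E a b → Adj E′ (e a) (e b)) where

  IsCycle-map : ∀ {c} → IsCycle E c → IsCycle E′ (map e c)
  IsCycle-map {x ∷ xs} (3≤ , c! , links) =
    subst (3 ≤_) (sym (length-map e (x ∷ xs))) 3≤ ,
    Unique.map⁺ e-injective c! ,
    subst (Linked (Adj E′)) (map-++ e (x ∷ xs) [ x ]) (Linked.map⁺ (Linked.map e-adj links))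

  InducesForest-preimage : ∀ {S} → InducesForest E′ (_∈ₛ S) → InducesForest E (_∈ₛ preimage e S)
  InducesForest-preimage {S} forest c cycle c⊆ =
    forest (map e c) (IsCycle-map cycle)
      (All.map⁺ (All.map (λ {x} x∈ → lookup⇒[]= (e x) S (∈-tabulate⁻ x∈)) c⊆))

allSubsets? : ∀ {n} {P : Subset n → Set} → Decidable P → Dec (∀ s → P s)
allSubsets? P? =
  map′ (λ ¬∃¬P s → decidable-stable (P? s) (¬∃¬P ∘ (s ,_))) (λ ∀P (s , ¬Ps) → ¬Ps (∀P s))
       (¬? (anySubset? (¬? ∘ P?)))

cycleCover⇒forestsSatisfy : ∀ {n} {E : EdgeList n} {cycles} → All (IsCycle E) cycles →
                            ∀ {P : Subset n → Set} → (∀ s → Any (All (_∈ₛ s)) cycles ⊎ P s) →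
                            ∀ s → InducesForest E (_∈ₛ s) → P s
cycleCover⇒forestsSatisfy areCycles cover s forest =
  [ (λ hit → let cycle , c⊆s = All.lookupAny areCycles hit in ⊥-elim (forest _ cycle c⊆s)) , id ]′
    (cover s)

innerVertices : List (Fin 10)
innerVertices = w ∷ z ∷ t ∷ x₁ ∷ x₂ ∷ x₃ ∷ x₄ ∷ x₅ ∷ []

innerBound : Bool → Bool → ℕ
innerBound false false = 5
innerBound true  true  = 2
innerBound _     _     = 4

baseWeights : List (Fin 10)
baseWeights = concatMap (uncurry replicate)
  ( (7 , u) ∷ (2 , v) ∷ (2 , w) ∷ (3 , z) ∷ (3 , t)
  ∷ (3 , x₁) ∷ (2 , x₂) ∷ (2 , x₃) ∷ (2 , x₄) ∷ (2 , x₅) ∷ [])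

gluingBound : Subset 10 → ℕ
gluingBound s = innerBound (s ! u) (s ! z) + (innerBound (s ! u) (s ! x₁) + innerBound (s ! u) (s ! t))

-- Every vertex set of W violating one of the two bounds below contains one of these cycles.
cyclesOfW : List (List (Fin 10))
cyclesOfW =
    (u ∷ z ∷ v ∷ []) ∷ (w ∷ x₂ ∷ x₃ ∷ []) ∷ (t ∷ x₅ ∷ x₄ ∷ []) ∷ (u ∷ x₁ ∷ x₅ ∷ [])
  ∷ (v ∷ x₃ ∷ x₄ ∷ []) ∷ (u ∷ v ∷ t ∷ []) ∷ (w ∷ x₂ ∷ x₁ ∷ []) ∷ (u ∷ z ∷ x₂ ∷ [])
  ∷ (w ∷ x₄ ∷ x₃ ∷ []) ∷ (v ∷ x₃ ∷ z ∷ []) ∷ (w ∷ x₄ ∷ x₅ ∷ []) ∷ (u ∷ x₅ ∷ t ∷ [])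
  ∷ (u ∷ x₁ ∷ x₂ ∷ []) ∷ (v ∷ x₄ ∷ t ∷ []) ∷ (w ∷ x₁ ∷ x₅ ∷ []) ∷ (z ∷ x₃ ∷ x₂ ∷ [])
  ∷ (u ∷ v ∷ x₄ ∷ x₅ ∷ []) ∷ (u ∷ x₂ ∷ x₃ ∷ v ∷ []) ∷ (u ∷ x₅ ∷ w ∷ x₂ ∷ [])
  ∷ (u ∷ x₅ ∷ x₄ ∷ x₃ ∷ z ∷ []) ∷ (u ∷ x₁ ∷ w ∷ x₄ ∷ v ∷ []) ∷ (u ∷ x₁ ∷ w ∷ x₄ ∷ t ∷ [])
  ∷ (u ∷ t ∷ x₄ ∷ x₃ ∷ z ∷ []) ∷ (u ∷ x₁ ∷ w ∷ x₃ ∷ v ∷ []) ∷ (u ∷ x₅ ∷ w ∷ x₃ ∷ z ∷ [])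
  ∷ (u ∷ x₂ ∷ w ∷ x₄ ∷ t ∷ []) ∷ (u ∷ x₂ ∷ x₃ ∷ x₄ ∷ x₅ ∷ []) ∷ (u ∷ v ∷ x₃ ∷ w ∷ x₅ ∷ [])
  ∷ (u ∷ v ∷ x₄ ∷ w ∷ x₂ ∷ []) ∷ (u ∷ x₁ ∷ w ∷ x₃ ∷ z ∷ []) ∷ (u ∷ t ∷ x₄ ∷ x₃ ∷ x₂ ∷ [])
  ∷ (v ∷ t ∷ x₅ ∷ x₁ ∷ x₂ ∷ z ∷ []) ∷ (v ∷ z ∷ x₂ ∷ w ∷ x₅ ∷ t ∷ [])
  ∷ (v ∷ x₃ ∷ x₂ ∷ x₁ ∷ x₅ ∷ t ∷ []) ∷ (v ∷ x₄ ∷ x₅ ∷ x₁ ∷ x₂ ∷ z ∷ [])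
  ∷ []

cyclesOfW-areCycles : All (IsCycle W) cyclesOfW
cyclesOfW-areCycles = from-yes (All.all? (IsCycle? W) cyclesOfW)

innerCount≤innerBound : ∀ s → InducesForest W (_∈ₛ s) →
                        count s innerVertices ≤ innerBound (s ! u) (s ! v)
innerCount≤innerBound = cycleCover⇒forestsSatisfy cyclesOfW-areCycles (from-yes (allSubsets? λ s →
  any? (All.all? (_∈ₛ? s)) cyclesOfW ⊎-dec count s innerVertices ≤? innerBound (s ! u) (s ! v)))

baseCount+gluingBound≤25 : ∀ s → InducesForest W (_∈ₛ s) → count s baseWeights + gluingBound s ≤ 25
baseCount+gluingBound≤25 = cycleCover⇒forestsSatisfy cyclesOfW-areCycles (from-yes (allSubsets? λ s →
  any? (All.all? (_∈ₛ? s)) cyclesOfW ⊎-dec count s baseWeights + gluingBound s ≤? 25))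

base-injective : ∀ {a b} → base a ≡ base b → a ≡ b
base-injective = ↑ˡ-injective 24 _ _

copyEmb-injective : ∀ j {a b} → copyEmb j a ≡ copyEmb j b → a ≡ b
copyEmb-injective j {a} {b} =
  from-yes (all? λ j → all? λ a → all? λ b → copyEmb j a ≟ copyEmb j b →-dec a ≟ b) j a b

base-adj : ∀ {a b} → Adj W a b → Adj W₁ (base a) (base b)
base-adj = Adj-mono ∈-++⁺ˡ ∘ Adj-mapEdges base

copyEmb-adj : ∀ j {a b} → Adj W a b → Adj W₁ (copyEmb j a) (copyEmb j b)
copyEmb-adj zero             = Adj-mono (∈-++⁺ʳ (edges base) ∘ ∈-++⁺ˡ) ∘ Adj-mapEdges _
  where edges = λ e → mapEdges e W
copyEmb-adj (suc zero)       =
  Adj-mono (∈-++⁺ʳ (edges base) ∘ ∈-++⁺ʳ (edges (copyEmb (# 0))) ∘ ∈-++⁺ˡ) ∘ Adj-mapEdges _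
  where edges = λ e → mapEdges e W
copyEmb-adj (suc (suc zero)) =
  Adj-mono (∈-++⁺ʳ (edges base) ∘ ∈-++⁺ʳ (edges (copyEmb (# 0))) ∘ ∈-++⁺ʳ (edges (copyEmb (# 1))))
  ∘ Adj-mapEdges _
  where edges = λ e → mapEdges e W

weights₁ : List (Fin 34)
weights₁ = map base baseWeights
        ++ map (copyEmb (# 0)) innerVertices
        ++ map (copyEmb (# 1)) innerVertices
        ++ map (copyEmb (# 2)) innerVertices

count-weights₁ : ∀ S → count S weights₁ ≡
  count (preimage base S) baseWeights
  + (count (preimage (copyEmb (# 0)) S) innerVertices
  + (count (preimage (copyEmb (# 1)) S) innerVertices
  +  count (preimage (copyEmb (# 2)) S) innerVertices))
count-weights₁ S = begin
  count S weights₁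
    ≡⟨ count-map-++ base baseWeights (map e₀ innerVertices ++ map e₁ innerVertices ++ map e₂ innerVertices) ⟩
  cB + count S (map e₀ innerVertices ++ map e₁ innerVertices ++ map e₂ innerVertices)
    ≡⟨ cong (cB +_) (count-map-++ e₀ innerVertices (map e₁ innerVertices ++ map e₂ innerVertices)) ⟩
  cB + (c₀ + count S (map e₁ innerVertices ++ map e₂ innerVertices))
    ≡⟨ cong (λ k → cB + (c₀ + k)) (count-map-++ e₁ innerVertices (map e₂ innerVertices)) ⟩
  cB + (c₀ + (c₁ + count S (map e₂ innerVertices)))
    ≡⟨ cong (λ k → cB + (c₀ + (c₁ + k))) (count-map e₂ S innerVertices) ⟩
  cB + (c₀ + (c₁ + c₂)) ∎
  where
  open ≡-Reasoning
  e₀ = copyEmb (# 0)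
  e₁ = copyEmb (# 1)
  e₂ = copyEmb (# 2)
  cB = count (preimage base S) baseWeights
  c₀ = count (preimage e₀ S) innerVertices
  c₁ = count (preimage e₁ S) innerVertices
  c₂ = count (preimage e₂ S) innerVertices
  count-map-++ : ∀ {m} (e : Fin m → Fin 34) xs ys →
                 count S (map e xs ++ ys) ≡ count (preimage e S) xs + count S ys
  count-map-++ e xs ys = trans (count-++ S (map e xs) ys) (cong (_+ count S ys) (count-map e S xs))

weight₁≤25 : ∀ S → InducesForest W₁ (_∈ₛ S) → count S weights₁ ≤ 25
weight₁≤25 S forest = begin
  count S weights₁
    ≡⟨ count-weights₁ S ⟩
  count (preimage base S) baseWeights + (innerCount (# 0) + (innerCount (# 1) + innerCount (# 2)))
    ≤⟨ +-monoʳ-≤ (count (preimage base S) baseWeights)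
                 (+-mono-≤ (copy (# 0)) (+-mono-≤ (copy (# 1)) (copy (# 2)))) ⟩
  count (preimage base S) baseWeights + gluingBound (preimage base S)
    ≤⟨ baseCount+gluingBound≤25 (preimage base S) (InducesForest-preimage base-injective base-adj forest) ⟩
  25 ∎
  where
  open ≤-Reasoning
  innerCount : Fin 3 → ℕ
  innerCount j = count (preimage (copyEmb j) S) innerVertices
  copy : ∀ j → innerCount j ≤ innerBound (S ! base u) (S ! base (endpoint j))
  copy j = innerCount≤innerBound (preimage (copyEmb j) S)
             (InducesForest-preimage (copyEmb-injective j) (copyEmb-adj j) forest)

-- (multiplicity , forest) pairs, each forest in leaf order.  Vertex # (k + 2) of copy j of W is
-- vertex # (10 + 8 j + k) of W₁.
weightedForests : List (ℕ × List (Fin 34))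
weightedForests
  = (1 , # 11 ∷ # 12 ∷ # 14 ∷ # 10 ∷ # 16 ∷ # 25 ∷ # 18 ∷ # 22 ∷ # 19 ∷ # 5 ∷ # 2 ∷ # 7 ∷ # 1 ∷ # 4 ∷ # 27 ∷ # 30 ∷ # 26 ∷ # 33 ∷ [])
  ∷ (1 , # 11 ∷ # 12 ∷ # 13 ∷ # 15 ∷ # 16 ∷ # 25 ∷ # 18 ∷ # 22 ∷ # 19 ∷ # 5 ∷ # 2 ∷ # 7 ∷ # 1 ∷ # 4 ∷ # 27 ∷ # 30 ∷ # 26 ∷ # 33 ∷ [])
  ∷ (2 , # 2 ∷ # 3 ∷ # 8 ∷ # 4 ∷ # 10 ∷ # 17 ∷ # 18 ∷ # 20 ∷ # 23 ∷ # 19 ∷ # 0 ∷ # 26 ∷ # 33 ∷ [])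
  ∷ (2 , # 2 ∷ # 3 ∷ # 8 ∷ # 4 ∷ # 10 ∷ # 17 ∷ # 21 ∷ # 24 ∷ # 23 ∷ # 19 ∷ # 0 ∷ # 26 ∷ # 33 ∷ [])
  ∷ (1 , # 2 ∷ # 3 ∷ # 8 ∷ # 4 ∷ # 10 ∷ # 17 ∷ # 21 ∷ # 23 ∷ # 24 ∷ # 20 ∷ # 0 ∷ # 26 ∷ # 33 ∷ [])
  ∷ (2 , # 5 ∷ # 8 ∷ # 7 ∷ # 3 ∷ # 10 ∷ # 17 ∷ # 18 ∷ # 25 ∷ # 26 ∷ # 28 ∷ # 0 ∷ # 27 ∷ # 31 ∷ [])
  ∷ (2 , # 5 ∷ # 8 ∷ # 7 ∷ # 3 ∷ # 14 ∷ # 17 ∷ # 18 ∷ # 25 ∷ # 27 ∷ # 29 ∷ # 0 ∷ # 28 ∷ # 32 ∷ [])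
  ∷ (1 , # 5 ∷ # 8 ∷ # 7 ∷ # 3 ∷ # 14 ∷ # 17 ∷ # 18 ∷ # 25 ∷ # 29 ∷ # 0 ∷ # 27 ∷ # 31 ∷ # 32 ∷ [])
  ∷ (1 , # 5 ∷ # 7 ∷ # 8 ∷ # 4 ∷ # 10 ∷ # 11 ∷ # 12 ∷ # 13 ∷ # 18 ∷ # 25 ∷ # 0 ∷ # 26 ∷ # 33 ∷ [])
  ∷ (1 , # 5 ∷ # 7 ∷ # 8 ∷ # 4 ∷ # 10 ∷ # 12 ∷ # 15 ∷ # 11 ∷ # 18 ∷ # 25 ∷ # 0 ∷ # 26 ∷ # 33 ∷ [])
  ∷ (1 , # 5 ∷ # 7 ∷ # 8 ∷ # 4 ∷ # 13 ∷ # 16 ∷ # 15 ∷ # 11 ∷ # 18 ∷ # 25 ∷ # 0 ∷ # 26 ∷ # 33 ∷ [])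
  ∷ (1 , # 5 ∷ # 7 ∷ # 8 ∷ # 4 ∷ # 13 ∷ # 16 ∷ # 15 ∷ # 11 ∷ # 22 ∷ # 25 ∷ # 30 ∷ # 0 ∷ # 33 ∷ [])
  ∷ (1 , # 5 ∷ # 7 ∷ # 8 ∷ # 4 ∷ # 13 ∷ # 15 ∷ # 16 ∷ # 12 ∷ # 22 ∷ # 25 ∷ # 30 ∷ # 0 ∷ # 33 ∷ [])
  ∷ (4 , # 11 ∷ # 12 ∷ # 13 ∷ # 15 ∷ # 16 ∷ # 25 ∷ # 18 ∷ # 22 ∷ # 19 ∷ # 5 ∷ # 6 ∷ # 7 ∷ # 8 ∷ # 4 ∷ # 27 ∷ # 30 ∷ # 26 ∷ # 33 ∷ [])
  ∷ (6 , # 12 ∷ # 13 ∷ # 14 ∷ # 15 ∷ # 16 ∷ # 25 ∷ # 18 ∷ # 22 ∷ # 19 ∷ # 5 ∷ # 6 ∷ # 7 ∷ # 8 ∷ # 4 ∷ # 27 ∷ # 30 ∷ # 26 ∷ # 33 ∷ [])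
  ∷ (1 , # 1 ∷ # 2 ∷ # 9 ∷ # 13 ∷ # 15 ∷ # 16 ∷ # 12 ∷ # 21 ∷ # 23 ∷ # 24 ∷ # 20 ∷ # 29 ∷ # 0 ∷ # 27 ∷ # 31 ∷ # 32 ∷ [])
  ∷ (3 , # 1 ∷ # 2 ∷ # 9 ∷ # 13 ∷ # 15 ∷ # 16 ∷ # 12 ∷ # 21 ∷ # 23 ∷ # 24 ∷ # 20 ∷ # 29 ∷ # 0 ∷ # 28 ∷ # 31 ∷ # 32 ∷ [])
  ∷ (2 , # 2 ∷ # 9 ∷ # 17 ∷ # 10 ∷ # 14 ∷ # 11 ∷ # 3 ∷ # 1 ∷ # 4 ∷ # 19 ∷ # 20 ∷ # 21 ∷ # 22 ∷ # 24 ∷ # 27 ∷ # 30 ∷ # 26 ∷ # 33 ∷ [])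
  ∷ (1 , # 2 ∷ # 9 ∷ # 17 ∷ # 10 ∷ # 14 ∷ # 11 ∷ # 3 ∷ # 1 ∷ # 4 ∷ # 19 ∷ # 20 ∷ # 21 ∷ # 23 ∷ # 24 ∷ # 27 ∷ # 30 ∷ # 26 ∷ # 33 ∷ [])
  ∷ (3 , # 1 ∷ # 6 ∷ # 9 ∷ # 13 ∷ # 15 ∷ # 16 ∷ # 12 ∷ # 21 ∷ # 23 ∷ # 24 ∷ # 20 ∷ # 29 ∷ # 0 ∷ # 28 ∷ # 31 ∷ # 32 ∷ [])
  ∷ (3 , # 1 ∷ # 9 ∷ # 2 ∷ # 6 ∷ # 3 ∷ # 11 ∷ # 14 ∷ # 10 ∷ # 17 ∷ # 19 ∷ # 20 ∷ # 21 ∷ # 23 ∷ # 24 ∷ # 27 ∷ # 28 ∷ # 29 ∷ # 31 ∷ # 32 ∷ [])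
  ∷ (1 , # 1 ∷ # 9 ∷ # 2 ∷ # 6 ∷ # 3 ∷ # 11 ∷ # 14 ∷ # 10 ∷ # 17 ∷ # 20 ∷ # 21 ∷ # 22 ∷ # 23 ∷ # 24 ∷ # 27 ∷ # 28 ∷ # 29 ∷ # 31 ∷ # 32 ∷ [])
  ∷ (5 , # 1 ∷ # 9 ∷ # 2 ∷ # 6 ∷ # 3 ∷ # 11 ∷ # 14 ∷ # 10 ∷ # 17 ∷ # 20 ∷ # 21 ∷ # 22 ∷ # 23 ∷ # 24 ∷ # 28 ∷ # 29 ∷ # 30 ∷ # 31 ∷ # 32 ∷ [])
  ∷ (3 , # 1 ∷ # 9 ∷ # 17 ∷ # 10 ∷ # 14 ∷ # 11 ∷ # 3 ∷ # 6 ∷ # 5 ∷ # 19 ∷ # 22 ∷ # 18 ∷ # 25 ∷ # 28 ∷ # 29 ∷ # 30 ∷ # 31 ∷ # 32 ∷ [])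
  ∷ (1 , # 7 ∷ # 1 ∷ # 9 ∷ # 13 ∷ # 15 ∷ # 16 ∷ # 12 ∷ # 21 ∷ # 23 ∷ # 24 ∷ # 20 ∷ # 29 ∷ # 0 ∷ # 28 ∷ # 31 ∷ # 32 ∷ [])
  ∷ (2 , # 7 ∷ # 2 ∷ # 9 ∷ # 13 ∷ # 15 ∷ # 16 ∷ # 12 ∷ # 21 ∷ # 23 ∷ # 24 ∷ # 20 ∷ # 29 ∷ # 0 ∷ # 28 ∷ # 31 ∷ # 32 ∷ [])
  ∷ []

forests : List (List (Fin 34))
forests = concatMap (uncurry replicate) weightedForests

forests-leafOrder : ∀ c → LeafOrder W₁ (lookup forests c)
forests-leafOrder = from-yes (all? λ c → leafOrder? W₁ (lookup forests c))

open DecMembership (_≟_ {34}) using (_∈?_)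

colouring₁ : Fin 34 → Subset 52
colouring₁ v = tabulate λ c → isYes (v ∈? lookup forests c)

∈-colouring₁⁻ : ∀ {v c} → c ∈ₛ colouring₁ v → v ∈ lookup forests c
∈-colouring₁⁻ {v} c∈ =
  toWitness (Equivalence.from T-≡ (∈-tabulate⁻ {g = λ c → isYes (v ∈? lookup forests c)} c∈))

colouring₁-isFracArbColouring : FracArbColouring W₁ 52 25
colouring₁-isFracArbColouring =
  colouring₁ ,
  from-yes (all? λ v → ∣ colouring₁ v ∣ ≟ℕ 25) ,
  λ c → InducesForest-mono W₁ {T = _∈ lookup forests c} ∈-colouring₁⁻
          (LeafOrder⇒InducesForest W₁ (forests-leafOrder c))

theorem5 : FracArboricityIs W₁ 52 25
theorem5 = (52 , 25 , s≤s z≤n , s≤s z≤n , refl , colouring₁-isFracArbColouring) ,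
           λ p q _ _ → weighting⇒lowerBound weights₁ 25 weight₁≤25
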